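{- Let $D$ be a digraph, let $T$ be a normal spanning arborescence of $D$, and let $H$ be the normal assistant of $T$ in $D$. Let $\overline{T}$ and $\overline{H}$ be the solidifications of $T$ and $H$. Then the map $\zeta\colon\Omega(\overline{T})\to\Omega(\overline{H})$, which assigns to every end of $\overline{T}$ the end of $\overline{H}$ that contains it as a subset of rays, is bijective.
   Context: An arborescence is a rooted oriented tree $T$ containing a directed path from the root to every vertex. We write $v\le_T w$ if $T$ has a directed path from $v$ to $w$, and $\lfloor v\rfloor_T=\{w: v\le_T w\}$. A $T$-path is a non-trivial directed path in $D$ meeting $T$ exactly in its endvertices. The normal assistant $H$ of $T$ in $D$ is obtained from $T$ by adding an edge $vw$ for every two $\le_T$-incomparable $v,w$ for which $D$ has a $T$-path from $\lfloor v\rfloor_T$ to $\lfloor w\rfloor_T$. $T$ is normal if $H$ is acyclic; it is spanning if $V(T)=V(D)$. The solidification of $T$ (resp. $H$) is obtained by adding the edge $wv$ for every edge $vw\in E(T)$. For a digraph $G$, a ray (infinite directed path with a first vertex) is solid in $G$ if for every finite $X\subseteq V(G)$ it has a tail in some strong component of $G-X$. Two solid rays are equivalent if for every finite $X$ they have tails in the same strong component of $G-X$. The ends of $G$ are the equivalence classes, and $\Omega(G)$ denotes the set of ends. -}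

module Defs where

open import Data.Nat using (ℕ; _≤_; _<_)
open import Data.Product using (Σ; ∃; ∃-syntax; _×_; _,_)
open import Data.Sum using (_⊎_)
open import Data.Empty using (⊥)
open import Data.Unit using (⊤)
open import Data.List using (List; []; _∷_; _++_; length)
open import Data.List.Relation.Unary.All using (All)
open import Data.List.Relation.Unary.Linked using (Linked)
open import Data.List.Relation.Unary.Unique.Propositional using (Unique)
open import Data.List.Membership.Propositional using (_∉_)
open import Relation.Nullary using (¬_)
open import Relation.Binary.PropositionalEquality using (_≡_)
open import Relation.Binary.Construct.Closure.ReflexiveTransitive using (Star)
open import Relation.Binary.Construct.Closure.Transitive using (TransClosure)
open import Function.Definitions using (Injective)

ExcludedMiddle : Set₁
ExcludedMiddle = (P : Set) → P ⊎ ¬ P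

Und : {V : Set} → (V → V → Set) → V → V → Set
Und G x y = G x y ⊎ G y x

-- a cycle of length ≥ 3 (distinct vertices) in the underlying graph
UCycle : {V : Set} → (V → V → Set) → Set
UCycle {V} G = Σ V λ x → Σ (List V) λ ys →
  (2 ≤ length ys) × Unique (x ∷ ys) × Linked (Und G) (x ∷ ys ++ x ∷ [])

-- T (edge relation ET on the full vertex set V, i.e. spanning) is an
-- arborescence of D (edge relation E) with root r:
-- a subgraph of D which is an oriented tree (no loops, no antiparallel
-- edges, underlying graph connected and without cycles) containing a
-- directed path from r to every vertex.
record IsSpanningArborescence {V : Set} (E ET : V → V → Set) (r : V) : Set where
  field
    subgraph   : ∀ {x y} → ET x y → E x y
    oriented   : ∀ {x y} → ET x y → ¬ ET y x
    connected  : ∀ x y → Star (Und ET) x y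
    acyclicU   : ¬ UCycle ET
    rootReach  : ∀ v → Star ET r v

_≤[_]_ : {V : Set} → V → (V → V → Set) → V → Set
v ≤[ ET ] w = Star ET v w

Incomparable : {V : Set} → (V → V → Set) → V → V → Set
Incomparable ET v w = ¬ (v ≤[ ET ] w) × ¬ (w ≤[ ET ] v)

record TPath {V : Set} (E : V → V → Set) (inT : V → Set) (ET : V → V → Set)
             (x y : V) : Set where
  field
    mid       : List V
    interior  : All (λ v → ¬ inT v) mid
    chain     : Linked E (x ∷ mid ++ y ∷ [])
    distinct  : Unique (x ∷ mid ++ y ∷ [])
    startInT  : inT x
    endInT    : inT y
    notTEdge  : mid ≡ [] → ¬ ET x y

-- The normal assistant H of a spanning T (V(T) = V(D)) in D
NormalAssistant : {V : Set} → (E ET : V → V → Set) → V → V → Set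
NormalAssistant {V} E ET v w =
  ET v w ⊎
  (Incomparable ET v w ×
   (Σ V λ x → Σ V λ y → v ≤[ ET ] x × w ≤[ ET ] y × TPath E (λ _ → ⊤) ET x y))

Acyclic : {V : Set} → (V → V → Set) → Set
Acyclic {V} G = ∀ (v : V) → ¬ TransClosure G v v

IsNormal : {V : Set} → (E ET : V → V → Set) → Set
IsNormal E ET = Acyclic (NormalAssistant E ET)

Solidify : {V : Set} → (G ET : V → V → Set) → V → V → Set
Solidify G ET v w = G v w ⊎ ET w v

record Ray {V : Set} (G : V → V → Set) : Set where
  field
    at    : ℕ → V
    inj   : Injective _≡_ _≡_ at
    edge  : ∀ n → G (at n) (at (Data.Nat.suc n))
open Ray public

Reach : {V : Set} → (V → V → Set) → List V → V → V → Set
Reach G X = Star (λ x y → G x y × x ∉ X × y ∉ X)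

SameComp : {V : Set} → (V → V → Set) → List V → V → V → Set
SameComp G X a b = a ∉ X × b ∉ X × Reach G X a b × Reach G X b a

-- finite vertex sets X are represented by lists
Solid : {V : Set} → (G : V → V → Set) → Ray G → Set
Solid {V} G ρ = ∀ (X : List V) → ∃[ k ] (∀ n → k ≤ n → SameComp G X (at ρ k) (at ρ n))

Equiv : {V : Set} → (G : V → V → Set) → Ray G → Ray G → Set
Equiv {V} G ρ σ = ∀ (X : List V) → ∃[ k ] ∃[ j ]
  (∀ n m → k ≤ n → j ≤ m → SameComp G X (at ρ n) (at σ m))

liftRay : {V : Set} {G G' : V → V → Set} → (∀ {x y} → G x y → G' x y) → Ray G → Ray G'
liftRay f ρ = record { at = at ρ ; inj = inj ρ ; edge = λ n → f (edge ρ n) }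

open import Data.Sum using (inj₁; inj₂)
solidInclusion : {V : Set} (E ET : V → V → Set) →
  ∀ {x y} → Solidify ET ET x y → Solidify (NormalAssistant E ET) ET x y
solidInclusion E ET (inj₁ e) = inj₁ (inj₁ e)
solidInclusion E ET (inj₂ e) = inj₂ e

module Submission where

-- Deleting a finite down-closed set Y ∋ r from T̄ leaves the subtrees ⌊w⌋ rooted at the
-- children w of Y, each strongly connected. An edge of H̄ - Y from ⌊w⌋ to ⌊w'⌋ with w ≠ w'
-- is an H-edge between incomparable vertices of ⌊w⌋ and ⌊w'⌋, which yields the H-edge ww';
-- as H is acyclic, every strong component of H̄ - Y lies inside one subtree ⌊w⌋.
-- With Y the down-closure of a finite X this turns equivalence in H̄ into equivalence in T̄,
-- and it lets a solid ray of H̄ choose, one child at a time, a nested sequence of subtrees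
-- containing its tails, whose roots form an equivalent ray of T̄.

open import Defs
open import Data.Empty using (⊥; ⊥-elim)
open import Data.List using (List; []; _∷_; _++_; head)
open import Data.List.Membership.Propositional using (_∈_; _∉_)
open import Data.List.Membership.Propositional.Properties using (∈-++⁺ˡ; ∈-++⁺ʳ; ∈-++⁻; ∈-∃++)
open import Data.List.Relation.Unary.All as All using ([]; _∷_)
open import Data.List.Relation.Unary.All.Properties using (¬Any⇒All¬; ++⁻ˡ; ++⁻ʳ)
open import Data.List.Relation.Unary.AllPairs using ([]; _∷_)
open import Data.List.Relation.Unary.Any using (here; there)
open import Data.List.Relation.Unary.Linked using (Linked; []; [-]; _∷_)
open import Data.List.Relation.Unary.Unique.Propositional using (Unique)
open import Data.List.Relation.Unary.Unique.Propositional.Properties using (Unique[x∷xs]⇒x∉xs)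
open import Data.Maybe using (just)
open import Data.Maybe.Relation.Binary.Connected using (Connected; just; just-nothing)
open import Data.Nat using (ℕ; zero; suc; _⊔_; s≤s; z≤n) renaming (_≤_ to _≤ℕ_)
open import Data.Nat.Properties using (<-cmp; <⇒≢; m≤n⇒m<n∨m≡n; ≤-refl; ≤-trans; m≤m⊔n; m≤n⊔m)
open import Data.Product using (Σ; ∃-syntax; _×_; _,_; proj₁; proj₂)
open import Data.Sum using (_⊎_; inj₁; inj₂)
open import Data.Unit using (⊤)
open import Function using (flip)
open import Function.Definitions using (Injective)
open import Relation.Binary.Construct.Closure.ReflexiveTransitive as Star using (Star; ε; _◅_; _◅◅_)
open import Relation.Binary.Construct.Closure.Transitive using (TransClosure; [_]) renaming (_∷_ to _∷⁺_)
open import Relation.Binary.Definitions using (tri<; tri≈; tri>)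
open import Relation.Binary.PropositionalEquality using (_≡_; _≢_; refl; sym; trans; subst)
open import Relation.Nullary using (¬_)

module _ {A : Set} {R : A → A → Set} where

  _◅⁺_ : ∀ {x y z} → R x y → Star R y z → TransClosure R x z
  e ◅⁺ ε = [ e ]
  e ◅⁺ (f ◅ p) = e ∷⁺ (f ◅⁺ p)

  Star-unsnoc : ∀ {x y} → Star R x y → x ≡ y ⊎ ∃[ p ] (Star R x p × R p y)
  Star-unsnoc ε = inj₁ refl
  Star-unsnoc (e ◅ p) with Star-unsnoc p
  ... | inj₁ refl = inj₂ (_ , ε , e)
  ... | inj₂ (_ , q , f) = inj₂ (_ , e ◅ q , f)

  Acyclic⇒¬cycle : Acyclic R → ∀ {x y} → R x y → Star R y x → ⊥
  Acyclic⇒¬cycle acyclic e p = acyclic _ (e ◅⁺ p)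

  Acyclic⇒antisym : Acyclic R → ∀ {x y} → Star R x y → Star R y x → x ≡ y
  Acyclic⇒antisym acyclic ε _ = refl
  Acyclic⇒antisym acyclic (e ◅ p) q = ⊥-elim (Acyclic⇒¬cycle acyclic e (p ◅◅ q))

  Acyclic-⊆ : ∀ {S : A → A → Set} → (∀ {x y} → R x y → S x y) → Acyclic S → Acyclic R
  Acyclic-⊆ {S} R⊆S acyclic v c = acyclic v (map⁺ c)
    where
      map⁺ : ∀ {x y} → TransClosure R x y → TransClosure S x y
      map⁺ [ e ] = [ R⊆S e ]
      map⁺ (e ∷⁺ c) = R⊆S e ∷⁺ map⁺ c

  successors : ∀ {x y} → Star R x y → List A → List A
  successors ε rest = rest
  successors (_◅_ {j = z} _ p) rest = z ∷ successors p rest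

  walk : ∀ {x y} → Star R x y → List A → List A
  walk {x} p rest = x ∷ successors p rest

  ∈-walk⁻ : ∀ {u x y} (p : Star R x y) → u ∈ walk p [] → Star R u y
  ∈-walk⁻ p (here refl) = p
  ∈-walk⁻ (e ◅ p) (there u∈) = ∈-walk⁻ p u∈

  end∈walk : ∀ {x y} (p : Star R x y) → y ∈ walk p []
  end∈walk ε = here refl
  end∈walk (_ ◅ p) = there (end∈walk p)

  walk-repeats-start : ∀ {x y rest} (p : Star R x y) → x ∈ rest → ¬ Unique (walk p rest)
  walk-repeats-start p x∈rest unique = Unique[x∷xs]⇒x∉xs unique (∈-successors p x∈rest)
    where
      ∈-successors : ∀ {u x y rest} (p : Star R x y) → u ∈ rest → u ∈ successors p rest
      ∈-successors ε u∈ = u∈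
      ∈-successors (_ ◅ p) u∈ = there (∈-successors p u∈)

module _ {A : Set} {R : A → A → Set} {f : ℕ → A} (step : ∀ i → R (f i) (f (suc i))) where

  chain : ∀ {i j} → i ≤ℕ j → Star R (f i) (f j)
  chain {j = zero} z≤n = ε
  chain {j = suc j} i≤1+j with m≤n⇒m<n∨m≡n i≤1+j
  ... | inj₁ (s≤s i≤j) = chain i≤j ◅◅ Star.return (step j)
  ... | inj₂ refl = ε

  chain-injective : Acyclic R → Injective _≡_ _≡_ f
  chain-injective acyclic {i} {j} fi≡fj with <-cmp i j
  ... | tri< i<j _ _ = ⊥-elim (Acyclic⇒¬cycle acyclic (step i) (subst (Star R _) (sym fi≡fj) (chain i<j)))
  ... | tri≈ _ i≡j _ = i≡j
  ... | tri> _ _ j<i = ⊥-elim (Acyclic⇒¬cycle acyclic (step j) (subst (Star R _) fi≡fj (chain j<i)))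

module _ (em : ExcludedMiddle) {A : Set} {f : ℕ → A} (f-injective : Injective _≡_ _≡_ f) where

  eventually-≢ : ∀ x → ∃[ k ] (∀ n → k ≤ℕ n → f n ≢ x)
  eventually-≢ x with em (∃[ i ] f i ≡ x)
  ... | inj₁ (i , fi≡x) = suc i , λ n i<n fn≡x → <⇒≢ i<n (f-injective (trans fi≡x (sym fn≡x)))
  ... | inj₂ ∄i = 0 , λ n _ fn≡x → ∄i (n , fn≡x)

  eventually-∉ : ∀ X → ∃[ k ] (∀ n → k ≤ℕ n → f n ∉ X)
  eventually-∉ [] = 0 , λ _ _ ()
  eventually-∉ (x ∷ X) with eventually-≢ x | eventually-∉ X
  ... | k₁ , ≢x | k₂ , ∉X = k₁ ⊔ k₂ , λ
    { n k≤n (here fn≡x) → ≢x n (≤-trans (m≤m⊔n k₁ k₂) k≤n) fn≡x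
    ; n k≤n (there fn∈X) → ∉X n (≤-trans (m≤n⊔m k₁ k₂) k≤n) fn∈X }

NonBacktracking : {A : Set} → List A → Set
NonBacktracking (x ∷ y ∷ z ∷ L) = x ≢ z × NonBacktracking (y ∷ z ∷ L)
NonBacktracking _ = ⊤

module _ (em : ExcludedMiddle) {V : Set} {G : V → V → Set} (loopless : ∀ {x} → ¬ G x x) where

  private
    NonBacktracking-tail : ∀ {x : V} L → NonBacktracking (x ∷ L) → NonBacktracking L
    NonBacktracking-tail [] _ = _
    NonBacktracking-tail (_ ∷ []) _ = _
    NonBacktracking-tail (_ ∷ _ ∷ _) (_ , nb) = nb

    Linked-tail : ∀ {R : V → V → Set} {x L} → Linked R (x ∷ L) → Linked R L
    Linked-tail [-] = []
    Linked-tail (_ ∷ lk) = lk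

    Linked-prefix : ∀ {R : V → V → Set} (L : List V) {y zs} → Linked R (L ++ y ∷ zs) → Linked R (L ++ y ∷ [])
    Linked-prefix [] _ = [-]
    Linked-prefix (_ ∷ []) (e ∷ _) = e ∷ [-]
    Linked-prefix (_ ∷ _ ∷ L) (e ∷ lk) = e ∷ Linked-prefix (_ ∷ L) lk

    Unique-prefix : ∀ (ys : List V) {x} zs → Unique (ys ++ x ∷ zs) → Unique (x ∷ ys)
    Unique-prefix [] zs _ = [] ∷ []
    Unique-prefix (y ∷ ys) zs (y∉ ∷ u) with Unique-prefix ys zs u
    ... | x∉ys ∷ uys = ((λ x≡y → All.head (++⁻ʳ ys y∉) (sym x≡y)) ∷ x∉ys) ∷ (++⁻ˡ ys y∉ ∷ uys)

    closed-walk⇒UCycle : ∀ x ys zs → Linked (Und G) (x ∷ ys ++ x ∷ zs) →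
                         NonBacktracking (x ∷ ys ++ x ∷ zs) → Unique (x ∷ ys) → UCycle G
    closed-walk⇒UCycle x [] zs (inj₁ e ∷ _) _ _ = ⊥-elim (loopless e)
    closed-walk⇒UCycle x [] zs (inj₂ e ∷ _) _ _ = ⊥-elim (loopless e)
    closed-walk⇒UCycle x (_ ∷ []) zs _ (x≢x , _) _ = ⊥-elim (x≢x refl)
    closed-walk⇒UCycle x ys@(_ ∷ _ ∷ _) zs lk _ u = x , ys , s≤s (s≤s z≤n) , u , Linked-prefix (x ∷ ys) lk

  -- The first vertex repeated in a non-backtracking walk closes a cycle of length at least 3.
  repeating-walk⇒UCycle : ∀ L → Linked (Und G) L → NonBacktracking L → ¬ Unique L → UCycle G
  repeating-walk⇒UCycle [] _ _ ¬unique = ⊥-elim (¬unique [])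
  repeating-walk⇒UCycle (x ∷ L) lk nb ¬unique with em (Unique L)
  ... | inj₂ ¬uL = repeating-walk⇒UCycle L (Linked-tail lk) (NonBacktracking-tail L nb) ¬uL
  ... | inj₁ uL with em (x ∈ L)
  ...   | inj₂ x∉L = ⊥-elim (¬unique (¬Any⇒All¬ L x∉L ∷ uL))
  ...   | inj₁ x∈L with ∈-∃++ x∈L
  ...     | ys , zs , refl = closed-walk⇒UCycle x ys zs lk nb (Unique-prefix ys zs uL)

module _ {V : Set} {G R : V → V → Set} (asym : ∀ {x y} → R x y → ¬ R y x)
         (R⊆Und : ∀ {x y} → R x y → Und G x y) where

  walk-linked : ∀ {x y} (p : Star R x y) rest → Linked (Und G) (y ∷ rest) → Linked (Und G) (walk p rest)
  walk-linked ε rest lk = lk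
  walk-linked (e ◅ p) rest lk = R⊆Und e ∷ walk-linked p rest lk

  walk-nonBacktracking : ∀ {x y} (p : Star R x y) rest → Connected R (just y) (head rest) →
                         NonBacktracking (y ∷ rest) → NonBacktracking (walk p rest)
  walk-nonBacktracking ε rest _ nb = nb
  walk-nonBacktracking (e ◅ ε) [] _ _ = _
  walk-nonBacktracking (e ◅ ε) (_ ∷ rest) (just f) nb = (λ { refl → asym e f }) , nb
  walk-nonBacktracking (e ◅ (f ◅ p)) rest c nb = (λ { refl → asym e f }) , walk-nonBacktracking (f ◅ p) rest c nb

module _ {V : Set} {G G' : V → V → Set} (G⊆G' : ∀ {x y} → G x y → G' x y) where

  SameComp-⊆ : ∀ {X a b} → SameComp G X a b → SameComp G' X a b
  SameComp-⊆ (a∉ , b∉ , a→b , b→a) = a∉ , b∉ , Star.map lift a→b , Star.map lift b→a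
    where
      lift : ∀ {x y} → G x y × x ∉ _ × y ∉ _ → G' x y × x ∉ _ × y ∉ _
      lift (e , x∉ , y∉) = G⊆G' e , x∉ , y∉

  Solid-lift : (ρ : Ray G) → Solid G ρ → Solid G' (liftRay G⊆G' ρ)
  Solid-lift ρ solid X with solid X
  ... | k , tail = k , λ n k≤n → SameComp-⊆ (tail n k≤n)

  Equiv-lift : (ρ σ : Ray G) → Equiv G ρ σ → Equiv G' (liftRay G⊆G' ρ) (liftRay G⊆G' σ)
  Equiv-lift ρ σ equiv X with equiv X
  ... | k , j , tails = k , j , λ n m k≤n j≤m → SameComp-⊆ (tails n m k≤n j≤m)

module _ {V : Set} {G ET : V → V → Set} (down : ∀ {x y} → ET x y → G x y) (up : ∀ {x y} → ET y x → G x y)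
         (X : List V) {w : V} (clean : ∀ {x} → x ∈ X → ¬ w ≤[ ET ] x) where

  subtree-sameComp : ∀ {a b} → w ≤[ ET ] a → w ≤[ ET ] b → SameComp G X a b
  subtree-sameComp w≤a w≤b =
    outside w≤a , outside w≤b , ascend ε w≤a ◅◅ descend ε w≤b , ascend ε w≤b ◅◅ descend ε w≤a
    where
      outside : ∀ {u} → w ≤[ ET ] u → u ∉ X
      outside w≤u u∈X = clean u∈X w≤u

      descend : ∀ {s u} → w ≤[ ET ] s → Star ET s u → Reach G X s u
      descend w≤s ε = ε
      descend {s} w≤s (_◅_ {j = s'} e p) = (down e , outside w≤s , outside w≤s') ◅ descend w≤s' p
        where
          w≤s' : w ≤[ ET ] s'
          w≤s' = w≤s ◅◅ Star.return e

      ascend : ∀ {s u} → w ≤[ ET ] s → Star ET s u → Reach G X u s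
      ascend w≤s ε = ε
      ascend {s} w≤s (_◅_ {j = s'} e p) = ascend w≤s' p ◅◅ Star.return (up e , outside w≤s' , outside w≤s)
        where
          w≤s' : w ≤[ ET ] s'
          w≤s' = w≤s ◅◅ Star.return e

module Arborescence (em : ExcludedMiddle) {V : Set} {E ET : V → V → Set} {r : V}
                    (T : IsSpanningArborescence E ET r) (acyclic : Acyclic ET) where
  open IsSpanningArborescence T

  _≤ᵀ_ : V → V → Set
  u ≤ᵀ v = u ≤[ ET ] v

  ≤ᵀ-antisym : ∀ {u v} → u ≤ᵀ v → v ≤ᵀ u → u ≡ v
  ≤ᵀ-antisym = Acyclic⇒antisym acyclic

  -- Two parents a ≠ c of b make r ⋯ a → b ← c ⋯ r a non-backtracking closed walk.
  parent-unique : ∀ {a b c} → ET a b → ET c b → a ≡ c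
  parent-unique {a} {b} {c} a→b c→b with em (a ≡ c)
  ... | inj₁ a≡c = a≡c
  ... | inj₂ a≢c = ⊥-elim (acyclicU (repeating-walk⇒UCycle em (λ e → oriented e e) closed linked
                                       nonBacktracking (walk-repeats-start (rootReach a) (end∈walk back))))
    where
      back : Star (flip ET) b r
      back = c→b ◅ Star.reverse (λ e → e) (rootReach c)

      closed : List V
      closed = walk (rootReach a) (walk back [])

      linked : Linked (Und ET) closed
      linked = walk-linked oriented inj₁ (rootReach a) _ (inj₁ a→b ∷ walk-linked oriented inj₂ back [] [-])

      nonBacktracking : NonBacktracking closed
      nonBacktracking = walk-nonBacktracking oriented inj₁ (rootReach a) _ (just a→b)
                          (a≢c , walk-nonBacktracking oriented inj₂ back [] just-nothing _)

  ≤ᵀ-parent : ∀ {w v p} → w ≤ᵀ v → ET p v → w ≡ v ⊎ w ≤ᵀ p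
  ≤ᵀ-parent w≤v p→v with Star-unsnoc w≤v
  ... | inj₁ w≡v = inj₁ w≡v
  ... | inj₂ (_ , w≤p' , p'→v) with parent-unique p'→v p→v
  ...   | refl = inj₂ w≤p'

  ≤ᵀ-comparable : ∀ {a b u} → a ≤ᵀ u → b ≤ᵀ u → a ≤ᵀ b ⊎ b ≤ᵀ a
  ≤ᵀ-comparable ε b≤u = inj₂ b≤u
  ≤ᵀ-comparable (a→a' ◅ a'≤u) b≤u with ≤ᵀ-comparable a'≤u b≤u
  ... | inj₁ a'≤b = inj₁ (a→a' ◅ a'≤b)
  ... | inj₂ b≤a' with ≤ᵀ-parent b≤a' a→a'
  ...   | inj₁ refl = inj₁ (Star.return a→a')
  ...   | inj₂ b≤a = inj₂ b≤a

  ancestors : V → List V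
  ancestors v = walk (rootReach v) []

  ∈-ancestors⁻ : ∀ {u v} → u ∈ ancestors v → u ≤ᵀ v
  ∈-ancestors⁻ {v = v} = ∈-walk⁻ (rootReach v)

  ∈-ancestors⁺ : ∀ {u v} → u ≤ᵀ v → u ∈ ancestors v
  ∈-ancestors⁺ {u} {v} u≤v = ∈-walk (rootReach v) (rootReach u) u≤v
    where
      ∈-walk : ∀ {s v} (p : s ≤ᵀ v) → s ≤ᵀ u → u ≤ᵀ v → u ∈ walk p []
      ∈-walk ε s≤u u≤v = here (≤ᵀ-antisym u≤v s≤u)
      ∈-walk (s→s' ◅ p) s≤u u≤v with ≤ᵀ-comparable u≤v p
      ... | inj₂ s'≤u = there (∈-walk p s'≤u u≤v)
      ... | inj₁ u≤s' with ≤ᵀ-parent u≤s' s→s'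
      ...   | inj₁ refl = there (here refl)
      ...   | inj₂ u≤s = here (≤ᵀ-antisym u≤s s≤u)

  root∈ancestors : ∀ v → r ∈ ancestors v
  root∈ancestors v = ∈-ancestors⁺ (rootReach v)

  DownClosed : List V → Set
  DownClosed Y = ∀ {u y} → y ∈ Y → u ≤ᵀ y → u ∈ Y

  ancestors-downClosed : ∀ v → DownClosed (ancestors v)
  ancestors-downClosed v y∈ u≤y = ∈-ancestors⁺ (u≤y ◅◅ ∈-ancestors⁻ y∈)

  DownClosed-++ : ∀ {Y Z} → DownClosed Y → DownClosed Z → DownClosed (Y ++ Z)
  DownClosed-++ {Y} Y-down Z-down y∈ u≤y with ∈-++⁻ Y y∈
  ... | inj₁ y∈Y = ∈-++⁺ˡ (Y-down y∈Y u≤y)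
  ... | inj₂ y∈Z = ∈-++⁺ʳ Y (Z-down y∈Z u≤y)

  downClosure : List V → List V
  downClosure [] = ancestors r
  downClosure (x ∷ X) = ancestors x ++ downClosure X

  root∈downClosure : ∀ X → r ∈ downClosure X
  root∈downClosure [] = root∈ancestors r
  root∈downClosure (x ∷ X) = ∈-++⁺ʳ (ancestors x) (root∈downClosure X)

  ∈-downClosure⁺ : ∀ {X u x} → x ∈ X → u ≤ᵀ x → u ∈ downClosure X
  ∈-downClosure⁺ (here refl) u≤x = ∈-++⁺ˡ (∈-ancestors⁺ u≤x)
  ∈-downClosure⁺ {_ ∷ _} (there x∈X) u≤x = ∈-++⁺ʳ _ (∈-downClosure⁺ x∈X u≤x)

  downClosure-downClosed : ∀ X → DownClosed (downClosure X)
  downClosure-downClosed [] = ancestors-downClosed r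
  downClosure-downClosed (x ∷ X) = DownClosed-++ (ancestors-downClosed x) (downClosure-downClosed X)

  -- w is the root of the component of T - Y containing u.
  BranchRoot : List V → V → V → Set
  BranchRoot Y u w = w ≤ᵀ u × w ∉ Y × ∃[ p ] (ET p w × p ∈ Y)

  branchRoot-of-ancestors : ∀ {c u w} → c ≤ᵀ u → BranchRoot (ancestors c) u w → ET c w
  branchRoot-of-ancestors {c} c≤u (w≤u , w∉ , p , p→w , p∈) with ≤ᵀ-comparable c≤u w≤u
  ... | inj₂ w≤c = ⊥-elim (w∉ (∈-ancestors⁺ w≤c))
  ... | inj₁ c≤w with ≤ᵀ-parent c≤w p→w
  ...   | inj₁ refl = ⊥-elim (w∉ (∈-ancestors⁺ ε))
  ...   | inj₂ c≤p = subst (λ q → ET q _) (≤ᵀ-antisym (∈-ancestors⁻ p∈) c≤p) p→w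

  module Branches {Y : List V} (Y-down : DownClosed Y) (r∈Y : r ∈ Y) where

    childOfY-minimal : ∀ {w v p} → w ≤ᵀ v → w ∉ Y → ET p v → p ∈ Y → w ≡ v
    childOfY-minimal w≤v w∉ p→v p∈ with ≤ᵀ-parent w≤v p→v
    ... | inj₁ w≡v = w≡v
    ... | inj₂ w≤p = ⊥-elim (w∉ (Y-down p∈ w≤p))

    branchRoot-exists : ∀ {u} → u ∉ Y → ∃[ w ] BranchRoot Y u w
    branchRoot-exists u∉ = first-exit (rootReach _) r∈Y u∉
      where
        first-exit : ∀ {s u} → s ≤ᵀ u → s ∈ Y → u ∉ Y → ∃[ w ] BranchRoot Y u w
        first-exit ε s∈ u∉ = ⊥-elim (u∉ s∈)
        first-exit (_◅_ {j = s'} s→s' s'≤u) s∈ u∉ with em (s' ∈ Y)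
        ... | inj₁ s'∈ = first-exit s'≤u s'∈ u∉
        ... | inj₂ s'∉ = s' , s'≤u , s'∉ , _ , s→s' , s∈

    branchRoot-unique : ∀ {u w w'} → BranchRoot Y u w → BranchRoot Y u w' → w ≡ w'
    branchRoot-unique (w≤u , w∉ , _ , p→w , p∈) (w'≤u , w'∉ , _ , p'→w' , p'∈) with ≤ᵀ-comparable w≤u w'≤u
    ... | inj₁ w≤w' = childOfY-minimal w≤w' w∉ p'→w' p'∈
    ... | inj₂ w'≤w = sym (childOfY-minimal w'≤w w'∉ p→w p∈)

module NormalArborescence (em : ExcludedMiddle) {V : Set} {E ET : V → V → Set} {r : V}
                          (T : IsSpanningArborescence E ET r) (normal : IsNormal E ET) where
  open IsSpanningArborescence T using (rootReach)

  H Tb Hb : V → V → Set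
  H = NormalAssistant E ET
  Tb = Solidify ET ET
  Hb = Solidify H ET

  T-acyclic : Acyclic ET
  T-acyclic = Acyclic-⊆ inj₁ normal

  open Arborescence em T T-acyclic

  module BranchDynamics {Y : List V} (Y-down : DownClosed Y) (r∈Y : r ∈ Y) where
    open Branches Y-down r∈Y

    branchRoot-step : ∀ {u u' w w'} → Hb u u' → BranchRoot Y u w → BranchRoot Y u' w' → Star H w w'
    branchRoot-step (inj₁ (inj₁ u→u')) (w≤u , more) br' with branchRoot-unique (w≤u ◅◅ Star.return u→u' , more) br'
    ... | refl = ε
    branchRoot-step (inj₂ u'→u) br (w'≤u' , more) with branchRoot-unique br (w'≤u' ◅◅ Star.return u'→u , more)
    ... | refl = ε
    branchRoot-step {w = w} {w'} (inj₁ (inj₂ (_ , x , y , u≤x , u'≤y , tpath)))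
                    (w≤u , w∉ , _ , p→w , p∈) (w'≤u' , w'∉ , _ , p'→w' , p'∈) with em (w ≡ w')
    ... | inj₁ refl = ε
    ... | inj₂ w≢w' = Star.return (inj₂ ((w≰w' , w'≰w) , x , y , w≤u ◅◅ u≤x , w'≤u' ◅◅ u'≤y , tpath))
      where
        w≰w' : ¬ w ≤ᵀ w'
        w≰w' w≤w' = w≢w' (childOfY-minimal w≤w' w∉ p'→w' p'∈)

        w'≰w : ¬ w' ≤ᵀ w
        w'≰w w'≤w = w≢w' (sym (childOfY-minimal w'≤w w'∉ p→w p∈))

    branchRoot-reach : ∀ {u u' w w'} → Reach Hb Y u u' → BranchRoot Y u w → BranchRoot Y u' w' → Star H w w'
    branchRoot-reach ε br br' with branchRoot-unique br br'
    ... | refl = ε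
    branchRoot-reach ((h , _ , v∉) ◅ p) br br' with branchRoot-exists v∉
    ... | _ , brᵥ = branchRoot-step h br brᵥ ◅◅ branchRoot-reach p brᵥ br'

    branchRoot-sameComp : ∀ {a b w w'} → SameComp Hb Y a b → BranchRoot Y a w → BranchRoot Y b w' → w ≡ w'
    branchRoot-sameComp (_ , _ , a→b , b→a) br br' =
      Acyclic⇒antisym normal (branchRoot-reach a→b br br') (branchRoot-reach b→a br' br)

    solid-tail-in-branch : (σ : Ray Hb) → Solid Hb σ → ∃[ k ] ∃[ w ] (∀ n → k ≤ℕ n → BranchRoot Y (at σ n) w)
    solid-tail-in-branch σ σ-solid with σ-solid Y
    ... | k , tail with branchRoot-exists (proj₁ (tail k ≤-refl))
    ...   | w , br = k , w , λ n k≤n → in-branch (tail n k≤n)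
      where
        in-branch : ∀ {v} → SameComp Hb Y (at σ k) v → BranchRoot Y v w
        in-branch sc@(_ , v∉ , _) with branchRoot-exists v∉
        ... | _ , brᵥ with branchRoot-sameComp sc br brᵥ
        ...   | refl = brᵥ

  module _ (X : List V) where
    open BranchDynamics (downClosure-downClosed X) (root∈downClosure X)
    open Branches (downClosure-downClosed X) (root∈downClosure X)

    sameComp-downClosure : ∀ {a b} → SameComp Hb (downClosure X) a b → SameComp Tb X a b
    sameComp-downClosure sc@(a∉ , b∉ , _) with branchRoot-exists a∉ | branchRoot-exists b∉
    ... | w , br@(w≤a , w∉ , _) | _ , br'@(w≤b , _) with branchRoot-sameComp sc br br'
    ...   | refl = subtree-sameComp inj₁ inj₂ X (λ x∈ w≤x → w∉ (∈-downClosure⁺ x∈ w≤x)) w≤a w≤b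

  Equiv-unlift : (ρ σ : Ray Tb) →
                 Equiv Hb (liftRay (solidInclusion E ET) ρ) (liftRay (solidInclusion E ET) σ) → Equiv Tb ρ σ
  Equiv-unlift ρ σ equiv X with equiv (downClosure X)
  ... | k , j , tails = k , j , λ n m k≤n j≤m → sameComp-downClosure X (tails n m k≤n j≤m)

  module SolidRayOfHb (σ : Ray Hb) (σ-solid : Solid Hb σ) where

    EventuallyBelow : V → Set
    EventuallyBelow c = ∃[ k ] (∀ n → k ≤ℕ n → c ≤ᵀ at σ n)

    descend : ∀ {c} → EventuallyBelow c → ∃[ c' ] (ET c c' × EventuallyBelow c')
    descend {c} (k , c≤σ)
      with BranchDynamics.solid-tail-in-branch (ancestors-downClosed c) (root∈ancestors c) σ σ-solid
    ... | k₁ , w , in-branch =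
      w , branchRoot-of-ancestors (c≤σ K (m≤m⊔n k k₁)) (in-branch K (m≤n⊔m k k₁)) ,
      K , λ n K≤n → proj₁ (in-branch n (≤-trans (m≤n⊔m k k₁) K≤n))
      where
        K : ℕ
        K = k ⊔ k₁

    stage : ℕ → Σ V EventuallyBelow
    stage zero = r , 0 , λ n _ → rootReach (at σ n)
    stage (suc i) = proj₁ (descend (proj₂ (stage i))) , proj₂ (proj₂ (descend (proj₂ (stage i))))

    vertex : ℕ → V
    vertex i = proj₁ (stage i)

    vertex-step : ∀ i → ET (vertex i) (vertex (suc i))
    vertex-step i = proj₁ (proj₂ (descend (proj₂ (stage i))))

    ray : Ray Tb
    ray = record { at = vertex ; inj = chain-injective vertex-step T-acyclic ; edge = λ i → inj₁ (vertex-step i) }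

    eventually-clean-subtree : ∀ X → ∃[ k ] (∀ {x} → x ∈ X → ¬ vertex k ≤ᵀ x)
    eventually-clean-subtree X with eventually-∉ em {f = vertex} (inj ray) (downClosure X)
    ... | k , ∉X = k , λ x∈ k≤x → ∉X k ≤-refl (∈-downClosure⁺ x∈ k≤x)

    ray-solid : Solid Tb ray
    ray-solid X with eventually-clean-subtree X
    ... | k , clean = k , λ n k≤n → subtree-sameComp inj₁ inj₂ X clean ε (chain vertex-step k≤n)

    ray-equiv : Equiv Hb (liftRay (solidInclusion E ET) ray) σ
    ray-equiv X with eventually-clean-subtree X
    ... | k , clean with proj₂ (stage k)
    ...   | j , below = k , j , λ n m k≤n j≤m →
      subtree-sameComp (λ e → inj₁ (inj₁ e)) inj₂ X clean (chain vertex-step k≤n) (below m j≤m)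

lemma5p1 : ExcludedMiddle →
    (V : Set) (E ET : V → V → Set) (r : V) →
    IsSpanningArborescence E ET r →
    IsNormal E ET →
    let H  = NormalAssistant E ET
        Tb = Solidify ET ET
        Hb = Solidify H ET
        incl = solidInclusion E ET
    in
    -- ζ is well defined: each end of T̄ is contained in an end of H̄
    ((ρ : Ray Tb) → Solid Tb ρ → Solid Hb (liftRay incl ρ)) ×
    ((ρ σ : Ray Tb) → Solid Tb ρ → Solid Tb σ → Equiv Tb ρ σ →
       Equiv Hb (liftRay incl ρ) (liftRay incl σ)) ×
    -- ζ is injective
    ((ρ σ : Ray Tb) → Solid Tb ρ → Solid Tb σ →
       Equiv Hb (liftRay incl ρ) (liftRay incl σ) → Equiv Tb ρ σ) ×
    -- ζ is surjective
    ((σ : Ray Hb) → Solid Hb σ →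
       Σ (Ray Tb) λ ρ → Solid Tb ρ × Equiv Hb (liftRay incl ρ) σ)
lemma5p1 em V E ET r T normal =
  Solid-lift (solidInclusion E ET) ,
  (λ ρ σ _ _ → Equiv-lift (solidInclusion E ET) ρ σ) ,
  (λ ρ σ _ _ → Equiv-unlift ρ σ) ,
  (λ σ σ-solid → let open SolidRayOfHb σ σ-solid in ray , ray-solid , ray-equiv)
  where open NormalArborescence em T normal
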